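{- Let \(G\) be a finite simple connected graph with \(\Delta(G)\leq 4\), not isomorphic to \(O_3\). Let \(\{q_{1},q_{2},q_{3}\}\) be a triangle in \(K(G)\) that is contained in \(Q_{T_{1}}\cap Q_{T_{2}}\), where \(T_{1},T_{2}\) are internal triangles of \(G\). Then \(T_{1}=T_{2}\).
   Context: A clique is a maximal complete subgraph; \(K(G)\) is the intersection graph of the cliques of \(G\). A triangle \(T\) is internal if it is a clique and every edge of \(T\) is contained in a clique different from \(T\). For an internal triangle \(T\), \(Q_{T}=\{q\in K(G)\mid |q\cap T|\geq 2\}\). \(O_3\) is the complement of the disjoint union of three edges. -}

module Defs where

open import Data.Nat using (ℕ; _≤_; _/_)
open import Data.Fin using (Fin; toℕ)
open import Data.Fin.Subset using (Subset; _∈_; _⊆_; _∩_; ∣_∣; Nonempty)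
open import Data.Vec using (tabulate)
open import Data.Bool using (Bool; true; false; if_then_else_)
open import Data.Product using (Σ; _×_; ∃)
open import Relation.Binary.PropositionalEquality using (_≡_; _≢_)
open import Relation.Binary.Construct.Closure.ReflexiveTransitive using (Star)
open import Relation.Nullary using (¬_; does)
open import Data.Nat using (_≟_)
open import Data.Fin using () renaming (_≟_ to _≟ᶠ_)

record Graph (n : ℕ) : Set where
  field
    adj   : Fin n → Fin n → Bool
    sym   : ∀ x y → adj x y ≡ adj y x
    irrefl : ∀ x → adj x x ≡ false

open Graph public

module _ {n : ℕ} (G : Graph n) where

  Adj : Fin n → Fin n → Set
  Adj x y = adj G x y ≡ true

  Complete : Subset n → Set
  Complete S = ∀ x y → x ∈ S → y ∈ S → x ≢ y → Adj x y

  IsClique : Subset n → Set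
  IsClique S = Nonempty S × Complete S × (∀ T → Complete T → S ⊆ T → T ⊆ S)

  nbhd : Fin n → Subset n
  nbhd x = tabulate (λ y → adj G x y)

  degree : Fin n → ℕ
  degree x = ∣ nbhd x ∣

  MaxDegreeAtMost : ℕ → Set
  MaxDegreeAtMost d = ∀ x → degree x ≤ d

  Connected : Set
  Connected = ∀ x y → Star Adj x y

  IsInternalTriangle : Subset n → Set
  IsInternalTriangle T =
    IsClique T × ∣ T ∣ ≡ 3 ×
    (∀ x y → x ∈ T → y ∈ T → x ≢ y →
       Σ (Subset n) λ q → IsClique q × q ≢ T × x ∈ q × y ∈ q)

  InQ : Subset n → Subset n → Set
  InQ T q = IsClique q × 2 ≤ ∣ q ∩ T ∣

  KAdj : Subset n → Subset n → Set
  KAdj q q' = q ≢ q' × Nonempty (q ∩ q')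

  IsKTriangle : Subset n → Subset n → Subset n → Set
  IsKTriangle q₁ q₂ q₃ =
    IsClique q₁ × IsClique q₂ × IsClique q₃ ×
    KAdj q₁ q₂ × KAdj q₂ q₃ × KAdj q₁ q₃

record Iso {n m : ℕ} (G : Graph n) (H : Graph m) : Set where
  field
    to      : Fin n → Fin m
    from    : Fin m → Fin n
    from-to : ∀ x → from (to x) ≡ x
    to-from : ∀ y → to (from y) ≡ y
    pres    : ∀ x y → adj G x y ≡ adj H (to x) (to y)

-- O₃: complement of three disjoint edges {0,1},{2,3},{4,5} on Fin 6
o3adj : Fin 6 → Fin 6 → Bool
o3adj x y = if does (x ≟ᶠ y) then false
            else (if does ((toℕ x / 2) ≟ (toℕ y / 2)) then false else true)

O₃ : Graph 6
O₃ = record { adj = o3adj ; sym = symP ; irrefl = irr }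
  where
  open import Data.Fin using (zero; suc)
  open import Relation.Binary.PropositionalEquality using (refl)
  symP : ∀ x y → o3adj x y ≡ o3adj y x
  symP zero zero = refl
  symP zero (suc zero) = refl
  symP zero (suc (suc zero)) = refl
  symP zero (suc (suc (suc zero))) = refl
  symP zero (suc (suc (suc (suc zero)))) = refl
  symP zero (suc (suc (suc (suc (suc zero))))) = refl
  symP (suc zero) zero = refl
  symP (suc zero) (suc zero) = refl
  symP (suc zero) (suc (suc zero)) = refl
  symP (suc zero) (suc (suc (suc zero))) = refl
  symP (suc zero) (suc (suc (suc (suc zero)))) = refl
  symP (suc zero) (suc (suc (suc (suc (suc zero))))) = refl
  symP (suc (suc zero)) zero = refl
  symP (suc (suc zero)) (suc zero) = refl
  symP (suc (suc zero)) (suc (suc zero)) = refl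
  symP (suc (suc zero)) (suc (suc (suc zero))) = refl
  symP (suc (suc zero)) (suc (suc (suc (suc zero)))) = refl
  symP (suc (suc zero)) (suc (suc (suc (suc (suc zero))))) = refl
  symP (suc (suc (suc zero))) zero = refl
  symP (suc (suc (suc zero))) (suc zero) = refl
  symP (suc (suc (suc zero))) (suc (suc zero)) = refl
  symP (suc (suc (suc zero))) (suc (suc (suc zero))) = refl
  symP (suc (suc (suc zero))) (suc (suc (suc (suc zero)))) = refl
  symP (suc (suc (suc zero))) (suc (suc (suc (suc (suc zero))))) = refl
  symP (suc (suc (suc (suc zero)))) zero = refl
  symP (suc (suc (suc (suc zero)))) (suc zero) = refl
  symP (suc (suc (suc (suc zero)))) (suc (suc zero)) = refl
  symP (suc (suc (suc (suc zero)))) (suc (suc (suc zero))) = refl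
  symP (suc (suc (suc (suc zero)))) (suc (suc (suc (suc zero)))) = refl
  symP (suc (suc (suc (suc zero)))) (suc (suc (suc (suc (suc zero))))) = refl
  symP (suc (suc (suc (suc (suc zero))))) zero = refl
  symP (suc (suc (suc (suc (suc zero))))) (suc zero) = refl
  symP (suc (suc (suc (suc (suc zero))))) (suc (suc zero)) = refl
  symP (suc (suc (suc (suc (suc zero))))) (suc (suc (suc zero))) = refl
  symP (suc (suc (suc (suc (suc zero))))) (suc (suc (suc (suc zero)))) = refl
  symP (suc (suc (suc (suc (suc zero))))) (suc (suc (suc (suc (suc zero))))) = refl
  irr : ∀ x → o3adj x x ≡ false
  irr zero = refl
  irr (suc zero) = refl
  irr (suc (suc zero)) = refl
  irr (suc (suc (suc zero))) = refl
  irr (suc (suc (suc (suc zero)))) = refl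
  irr (suc (suc (suc (suc (suc zero))))) = refl

-- In a graph of maximum degree 4, two vertices x, y of an internal triangle T have at
-- most one common neighbour outside T: the clique other than T through a second edge xc
-- of T gives x a neighbour z outside T, and two such common neighbours together with
-- y, c and z would be five neighbours of x. Hence the clique other than T through the
-- edge xy is unique, and it is {x, y, w} for that common neighbour w.
-- Now let T₁ ≠ T₂. As the three cliques qᵢ are distinct, one of them, q, differs from
-- both T₁ and T₂; then q = {x, y, w} over an edge xy of T₁ and q meets T₂ in two
-- vertices, which forces T₁ ∩ T₂ to be a single vertex s. Every qᵢ then contains s and
-- a second vertex tᵢ of T₁, and the tᵢ are distinct because the edge s tᵢ determines qᵢ;
-- so T₁ would have four vertices.
module Submission where

open import Defs hiding (sym)
open import Data.Nat using (ℕ; suc; _≤_; _<_; z≤n; s≤s)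
open import Data.Nat.Properties using (≤-refl; ≤-trans; ≤-pred; ≤-reflexive; n≤1+n; <-irrefl; <⇒≱)
open import Data.Bool using () renaming (_≟_ to _≟ᵇ_)
open import Data.Fin using (Fin; zero; suc; _≟_)
open import Data.Fin.Subset using (Subset; inside; outside; _∈_; _∉_; _⊆_; _∩_; _∪_; _-_; ⁅_⁆; ∣_∣)
open import Data.Fin.Subset.Properties
  using ( _∈?_; nonempty?; Empty-unique; ∣⊥∣≡0; drop-there; ⊆-antisym; p⊆q⇒∣p∣≤∣q∣
        ; p─q─q≡p─q; p─q⊆p; x∈p⇒∣p-x∣<∣p∣; x∈p∧x≢y⇒x∈p-y; x∈p∩q⁻
        ; p⊆p∪q; x∈p∪q⁺; x∈p∪q⁻; x∈⁅x⁆; x∈⁅y⁆⇒x≡y)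
open import Data.Fin.Properties using (any?)
open import Data.List using (List; []; _∷_; length)
open import Data.List.Relation.Unary.All as All using (All; []; _∷_)
open import Data.List.Relation.Unary.AllPairs using (AllPairs; []; _∷_)
open import Data.Product using (∃; ∃₂; _×_; _,_; proj₁; proj₂)
open import Data.Sum using (_⊎_; inj₁; inj₂)
open import Data.Empty using (⊥; ⊥-elim)
open import Data.Vec using (_∷_; there)
open import Data.Vec.Properties using (≡-dec; lookup⇒[]=; lookup∘tabulate)
open import Relation.Binary.Definitions using (DecidableEquality)
open import Relation.Binary.PropositionalEquality using (_≡_; _≢_; refl; sym; trans; cong; subst; ≢-sym)
open import Relation.Nullary using (¬_; yes; no; contradiction)
open import Relation.Nullary.Decidable using (_×-dec_; ¬?)

private variable
  n : ℕ
  p p′ q q′ q₁ q₂ q₃ T T₁ T₂ : Subset n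
  a b c s t u v w w′ x y : Fin n

x∉p-x : x ∉ p - x
x∉p-x {x = x} {p} x∈p-x = <-irrefl (cong ∣_∣ (p─q─q≡p─q p ⁅ x ⁆)) (x∈p⇒∣p-x∣<∣p∣ x∈p-x)

∣p∣≤1+∣p-x∣ : (p : Subset n) (x : Fin n) → ∣ p ∣ ≤ suc ∣ p - x ∣
-- (s ∷ p) - zero does not reduce to outside ∷ p, as _─_ zips with a local helper.
∣p∣≤1+∣p-x∣ (s ∷ p) zero =
  ≤-trans (∣s∷p∣≤1+∣p∣ s) (s≤s (p⊆q⇒∣p∣≤∣q∣ λ y∈p →
    drop-there (x∈p∧x≢y⇒x∈p-y {p = s ∷ p} {y = zero} (there y∈p) λ ())))
  where
  ∣s∷p∣≤1+∣p∣ : ∀ s → ∣ s ∷ p ∣ ≤ suc ∣ p ∣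
  ∣s∷p∣≤1+∣p∣ inside  = ≤-refl
  ∣s∷p∣≤1+∣p∣ outside = n≤1+n _
∣p∣≤1+∣p-x∣ (inside  ∷ p) (suc x) = s≤s (∣p∣≤1+∣p-x∣ p x)
∣p∣≤1+∣p-x∣ (outside ∷ p) (suc x) = ∣p∣≤1+∣p-x∣ p x

length<∣p∣⇒fresh : (p : Subset n) (xs : List (Fin n)) → length xs < ∣ p ∣ →
        ∃ λ v → v ∈ p × All (v ≢_) xs
length<∣p∣⇒fresh {n} p [] 0<∣p∣ with nonempty? p
... | yes (v , v∈p) = v , v∈p , []
... | no empty = contradiction 0<∣p∣ (<-irrefl (sym (trans (cong ∣_∣ (Empty-unique empty)) (∣⊥∣≡0 n))))
length<∣p∣⇒fresh p (x ∷ xs) xs<∣p∣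
  with length<∣p∣⇒fresh (p - x) xs (≤-pred (≤-trans xs<∣p∣ (∣p∣≤1+∣p-x∣ p x)))
... | v , v∈p-x , v∉xs = v , p─q⊆p p ⁅ x ⁆ v∈p-x , (λ { refl → x∉p-x v∈p-x }) ∷ v∉xs

distinct⇒length≤∣p∣ : {xs : List (Fin n)} → AllPairs _≢_ xs → All (_∈ p) xs → length xs ≤ ∣ p ∣
distinct⇒length≤∣p∣ [] [] = z≤n
distinct⇒length≤∣p∣ {p = p} {x ∷ xs} (x≢xs ∷ distinct) (x∈p ∷ xs⊆p) =
  ≤-trans (s≤s (distinct⇒length≤∣p∣ {p = p - x} distinct xs⊆p-x)) (x∈p⇒∣p-x∣<∣p∣ x∈p)
  where
  xs⊆p-x : All (_∈ p - x) xs
  xs⊆p-x = All.zipWith (λ (y∈p , x≢y) → x∈p∧x≢y⇒x∈p-y y∈p (≢-sym x≢y)) (xs⊆p , x≢xs)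

common-pair : 2 ≤ ∣ p ∩ q ∣ → ∃₂ λ x y → x ∈ p × x ∈ q × y ∈ p × y ∈ q × x ≢ y
common-pair {p = p} {q} 2≤∣p∩q∣ with length<∣p∣⇒fresh (p ∩ q) [] (≤-trans (n≤1+n 1) 2≤∣p∩q∣)
... | x , x∈p∩q , [] with length<∣p∣⇒fresh (p ∩ q) (x ∷ []) 2≤∣p∩q∣
... | y , y∈p∩q , y≢x ∷ [] with x∈p∩q⁻ p q x∈p∩q | x∈p∩q⁻ p q y∈p∩q
... | x∈p , x∈q | y∈p , y∈q = x , y , x∈p , x∈q , y∈p , y∈q , ≢-sym y≢x

∈∉⇒≢ : x ∈ p → y ∉ p → x ≢ y
∈∉⇒≢ x∈p y∉p refl = y∉p x∈p

Within : Subset n → Fin n → Fin n → Fin n → Set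
Within p a b c = ∀ {v} → v ∈ p → v ≡ a ⊎ v ≡ b ⊎ v ≡ c

within-⊆ : Within p a b c → a ∈ q → b ∈ q → c ∈ q → p ⊆ q
within-⊆ p-within a∈q b∈q c∈q v∈p with p-within v∈p
... | inj₁ refl        = a∈q
... | inj₂ (inj₁ refl) = b∈q
... | inj₂ (inj₂ refl) = c∈q

within-excluding : Within p a b c → v ∈ p → v ∈ q → b ∉ q → c ∉ q → v ≡ a
within-excluding p-within v∈p v∈q b∉q c∉q with p-within v∈p
... | inj₁ v≡a         = v≡a
... | inj₂ (inj₁ refl) = contradiction v∈q b∉q
... | inj₂ (inj₂ refl) = contradiction v∈q c∉q

within-two : Within p a b c → u ∈ p → v ∈ p → u ≢ v → u ∈ q → v ∈ q → a ∈ q ⊎ b ∈ q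
within-two p-within u∈p v∈p u≢v u∈q v∈q with p-within u∈p | p-within v∈p
... | inj₁ refl        | _                = inj₁ u∈q
... | inj₂ (inj₁ refl) | _                = inj₂ u∈q
... | inj₂ (inj₂ refl) | inj₁ refl        = inj₁ v∈q
... | inj₂ (inj₂ refl) | inj₂ (inj₁ refl) = inj₂ v∈q
... | inj₂ (inj₂ refl) | inj₂ (inj₂ refl) = contradiction refl u≢v

∣p∣≡3⇒within : ∣ p ∣ ≡ 3 → a ∈ p → b ∈ p → c ∈ p → a ≢ b → a ≢ c → b ≢ c → Within p a b c
∣p∣≡3⇒within {a = a} {b = b} {c = c} ∣p∣≡3 a∈p b∈p c∈p a≢b a≢c b≢c {v} v∈p with v ≟ a | v ≟ b | v ≟ c
... | yes v≡a | _       | _       = inj₁ v≡a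
... | no _    | yes v≡b | _       = inj₂ (inj₁ v≡b)
... | no _    | no _    | yes v≡c = inj₂ (inj₂ v≡c)
... | no v≢a  | no v≢b  | no v≢c  = ⊥-elim (
  <⇒≱ (≤-reflexive (cong suc ∣p∣≡3))
      (distinct⇒length≤∣p∣ ((a≢b ∷ a≢c ∷ ≢-sym v≢a ∷ []) ∷ (b≢c ∷ ≢-sym v≢b ∷ []) ∷ (≢-sym v≢c ∷ []) ∷ [] ∷ [])
                           (a∈p ∷ b∈p ∷ c∈p ∷ v∈p ∷ [])))

∣p∣≡3⇒third : ∣ p ∣ ≡ 3 → (x y : Fin n) → ∃ λ c → c ∈ p × c ≢ x × c ≢ y
∣p∣≡3⇒third {p = p} ∣p∣≡3 x y with length<∣p∣⇒fresh p (x ∷ y ∷ []) (≤-reflexive (sym ∣p∣≡3))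
... | c , c∈p , c≢x ∷ c≢y ∷ [] = c , c∈p , c≢x , c≢y

avoid-two : ∀ {A : Set} {P : A → Set} → DecidableEquality A → ∀ {a b c} →
            a ≢ b → b ≢ c → a ≢ c → P a → P b → P c →
            ∀ u w → ∃ λ z → P z × z ≢ u × z ≢ w
avoid-two _≟_ {a} {b} {c} a≢b b≢c a≢c Pa Pb Pc u w with a ≟ u | a ≟ w
... | no a≢u | no a≢w = a , Pa , a≢u , a≢w
... | yes refl | _ with b ≟ w
...   | no b≢w   = b , Pb , ≢-sym a≢b , b≢w
...   | yes refl = c , Pc , ≢-sym a≢c , ≢-sym b≢c
avoid-two _≟_ {a} {b} {c} a≢b b≢c a≢c Pa Pb Pc u w | no _ | yes refl with b ≟ u
...   | no b≢u   = b , Pb , b≢u , ≢-sym a≢b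
...   | yes refl = c , Pc , ≢-sym b≢c , ≢-sym a≢c

MeetsOnlyAt : Subset n → Subset n → Fin n → Set
MeetsOnlyAt p q s = ∀ {v} → v ∈ p → v ∈ q → v ≡ s

module _ {n : ℕ} (G : Graph n) where

  Adj-sym : Adj G x y → Adj G y x
  Adj-sym {x = x} {y} x∼y = trans (Graph.sym G y x) x∼y

  adj-across : Complete G p → x ∈ p → y ∈ p → x ∈ q → y ∉ q → Adj G x y
  adj-across {x = x} {y} p-complete x∈p y∈p x∈q y∉q = p-complete x y x∈p y∈p (∈∉⇒≢ x∈q y∉q)

  clique-complete : IsClique G p → Complete G p
  clique-complete (_ , p-complete , _) = p-complete

  clique⊆complete⇒≡ : IsClique G p → Complete G q → p ⊆ q → p ≡ q
  clique⊆complete⇒≡ (_ , _ , maximal) q-complete p⊆q = ⊆-antisym p⊆q (maximal _ q-complete p⊆q)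

  clique≢⇒outsider : IsClique G p → Complete G q → p ≢ q → ∃ λ z → z ∈ p × z ∉ q
  clique≢⇒outsider {p = p} {q} p-clique q-complete p≢q with any? (λ z → (z ∈? p) ×-dec ¬? (z ∈? q))
  ... | yes outsider = outsider
  ... | no none = contradiction (clique⊆complete⇒≡ p-clique q-complete p⊆q) p≢q
    where
    p⊆q : p ⊆ q
    p⊆q {z} z∈p with z ∈? q
    ... | yes z∈q = z∈q
    ... | no z∉q = contradiction (z , z∈p , z∉q) none

  clique-¬common-neighbour : IsClique G p → v ∉ p → (∀ {u} → u ∈ p → Adj G u v) → ⊥
  clique-¬common-neighbour {p = p} {v} (_ , p-complete , maximal) v∉p common =
    v∉p (maximal (p ∪ ⁅ v ⁆) extended-complete (p⊆p∪q ⁅ v ⁆) (x∈p∪q⁺ (inj₂ (x∈⁅x⁆ v))))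
    where
    extended-complete : Complete G (p ∪ ⁅ v ⁆)
    extended-complete x y x∈ y∈ x≢y with x∈p∪q⁻ p ⁅ v ⁆ x∈ | x∈p∪q⁻ p ⁅ v ⁆ y∈
    ... | inj₁ x∈p | inj₁ y∈p = p-complete x y x∈p y∈p x≢y
    ... | inj₁ x∈p | inj₂ y∈v rewrite x∈⁅y⁆⇒x≡y v y∈v = common x∈p
    ... | inj₂ x∈v | inj₁ y∈p rewrite x∈⁅y⁆⇒x≡y v x∈v = Adj-sym (common y∈p)
    ... | inj₂ x∈v | inj₂ y∈v = contradiction (trans (x∈⁅y⁆⇒x≡y v x∈v) (sym (x∈⁅y⁆⇒x≡y v y∈v))) x≢y

  triangle-¬common-neighbour : IsClique G p → Within p a b c → v ∉ p →
                               Adj G a v → Adj G b v → Adj G c v → ⊥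
  triangle-¬common-neighbour {p = p} {a} {b} {c} {v} p-clique p-within v∉p a∼v b∼v c∼v =
    clique-¬common-neighbour p-clique v∉p common
    where
    common : ∀ {u} → u ∈ p → Adj G u v
    common u∈p with p-within u∈p
    ... | inj₁ refl        = a∼v
    ... | inj₂ (inj₁ refl) = b∼v
    ... | inj₂ (inj₂ refl) = c∼v

  Adj⇒∈nbhd : Adj G x y → y ∈ nbhd G x
  Adj⇒∈nbhd {x = x} {y} x∼y = lookup⇒[]= y (nbhd G x) (trans (lookup∘tabulate (adj G x) y) x∼y)

  distinct-neighbours≤degree : {xs : List (Fin n)} → AllPairs _≢_ xs → All (Adj G x) xs →
                               length xs ≤ degree G x
  distinct-neighbours≤degree {x = x} distinct adjacent =
    distinct⇒length≤∣p∣ {p = nbhd G x} distinct (All.map Adj⇒∈nbhd adjacent)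

  only-common-vertex : IsClique G p → ∣ p ∣ ≡ 3 → Complete G q → s ∈ p → t ∈ p → s ≢ t → t ∉ q →
                       w ∈ q → w ∉ p → Adj G s w → Adj G t w → MeetsOnlyAt p q s
  only-common-vertex {s = s} p-clique ∣p∣≡3 q-complete s∈p t∈p s≢t t∉q w∈q w∉p s∼w t∼w {v} v∈p v∈q
    with v ≟ s
  ... | yes v≡s = v≡s
  ... | no v≢s  = ⊥-elim (triangle-¬common-neighbour p-clique
                    (∣p∣≡3⇒within ∣p∣≡3 s∈p t∈p v∈p s≢t (≢-sym v≢s) (≢-sym (∈∉⇒≢ v∈q t∉q)))
                    w∉p s∼w t∼w (adj-across q-complete v∈q w∈q v∈p w∉p))

  module _ (Δ≤4 : MaxDegreeAtMost G 4) where

    apex-unique : IsInternalTriangle G T → x ∈ T → y ∈ T → x ≢ y → w ∉ T → w′ ∉ T →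
                  Adj G x w → Adj G y w → Adj G x w′ → Adj G y w′ → w ≡ w′
    apex-unique {T = T} {x} {y} {w} {w′} (T-clique , ∣T∣≡3 , internal) x∈T y∈T x≢y w∉T w′∉T x∼w y∼w x∼w′ y∼w′
      with w ≟ w′ | ∣p∣≡3⇒third ∣T∣≡3 x y
    ... | yes w≡w′ | _ = w≡w′
    ... | no w≢w′ | c , c∈T , c≢x , c≢y with internal x c x∈T c∈T (≢-sym c≢x)
    ... | q , q-clique , q≢T , x∈q , c∈q with clique≢⇒outsider q-clique (clique-complete T-clique) q≢T
    ... | z , z∈q , z∉T = ⊥-elim (<⇒≱ (s≤s (Δ≤4 x)) (distinct-neighbours≤degree distinct adjacent))
      where
      T-within : Within T x y c
      T-within = ∣p∣≡3⇒within ∣T∣≡3 x∈T y∈T c∈T x≢y (≢-sym c≢x) (≢-sym c≢y)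
      c∼z : Adj G c z
      c∼z = adj-across (clique-complete q-clique) c∈q z∈q c∈T z∉T
      z≢w : z ≢ w
      z≢w refl = triangle-¬common-neighbour T-clique T-within w∉T x∼w y∼w c∼z
      z≢w′ : z ≢ w′
      z≢w′ refl = triangle-¬common-neighbour T-clique T-within w′∉T x∼w′ y∼w′ c∼z
      adjacent : All (Adj G x) (y ∷ c ∷ w ∷ w′ ∷ z ∷ [])
      adjacent = clique-complete T-clique x y x∈T y∈T x≢y
               ∷ clique-complete T-clique x c x∈T c∈T (≢-sym c≢x)
               ∷ x∼w ∷ x∼w′
               ∷ adj-across (clique-complete q-clique) x∈q z∈q x∈T z∉T ∷ []
      distinct : AllPairs _≢_ (y ∷ c ∷ w ∷ w′ ∷ z ∷ [])
      distinct = (≢-sym c≢y ∷ ∈∉⇒≢ y∈T w∉T ∷ ∈∉⇒≢ y∈T w′∉T ∷ ∈∉⇒≢ y∈T z∉T ∷ [])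
               ∷ (∈∉⇒≢ c∈T w∉T ∷ ∈∉⇒≢ c∈T w′∉T ∷ ∈∉⇒≢ c∈T z∉T ∷ [])
               ∷ (w≢w′ ∷ ≢-sym z≢w ∷ [])
               ∷ (≢-sym z≢w′ ∷ [])
               ∷ [] ∷ []

    apex-unique-complete : IsInternalTriangle G T → x ∈ T → y ∈ T → x ≢ y →
                           Complete G p → x ∈ p → y ∈ p → w ∈ p → w ∉ T →
                           Complete G p′ → x ∈ p′ → y ∈ p′ → w′ ∈ p′ → w′ ∉ T → w ≡ w′
    apex-unique-complete iT x∈T y∈T x≢y p-complete x∈p y∈p w∈p w∉T p′-complete x∈p′ y∈p′ w′∈p′ w′∉T =
      apex-unique iT x∈T y∈T x≢y w∉T w′∉T
        (adj-across p-complete x∈p w∈p x∈T w∉T) (adj-across p-complete y∈p w∈p y∈T w∉T)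
        (adj-across p′-complete x∈p′ w′∈p′ x∈T w′∉T) (adj-across p′-complete y∈p′ w′∈p′ y∈T w′∉T)

    edge-clique-within : IsInternalTriangle G T → x ∈ T → y ∈ T → x ≢ y →
                         IsClique G q → x ∈ q → y ∈ q → w ∈ q → w ∉ T → Within q x y w
    edge-clique-within {T = T} {x} {y} {q} {w} iT@(T-clique , ∣T∣≡3 , _) x∈T y∈T x≢y
                       q-clique x∈q y∈q w∈q w∉T {v} v∈q
      with v ≟ x | v ≟ y | v ∈? T
    ... | yes v≡x | _       | _      = inj₁ v≡x
    ... | no _    | yes v≡y | _      = inj₂ (inj₁ v≡y)
    ... | no v≢x  | no v≢y  | yes v∈T = contradiction (subst (w ∈_) (sym T≡q) w∈q) w∉T
      where
      T≡q : T ≡ q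
      T≡q = clique⊆complete⇒≡ T-clique (clique-complete q-clique)
              (within-⊆ (∣p∣≡3⇒within ∣T∣≡3 x∈T y∈T v∈T x≢y (≢-sym v≢x) (≢-sym v≢y)) x∈q y∈q v∈q)
    ... | no _    | no _    | no v∉T = inj₂ (inj₂ (apex-unique-complete iT x∈T y∈T x≢y
                                         q-complete x∈q y∈q v∈q v∉T q-complete x∈q y∈q w∈q w∉T))
      where
      q-complete : Complete G q
      q-complete = clique-complete q-clique

    edge-clique-unique : IsInternalTriangle G T → x ∈ T → y ∈ T → x ≢ y →
                         IsClique G q → q ≢ T → x ∈ q → y ∈ q →
                         IsClique G q′ → q′ ≢ T → x ∈ q′ → y ∈ q′ → q ≡ q′
    edge-clique-unique {q = q} {q′ = q′} iT@(T-clique , _) x∈T y∈T x≢y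
                       q-clique q≢T x∈q y∈q q′-clique q′≢T x∈q′ y∈q′
      with clique≢⇒outsider q-clique (clique-complete T-clique) q≢T
         | clique≢⇒outsider q′-clique (clique-complete T-clique) q′≢T
    ... | w , w∈q , w∉T | w′ , w′∈q′ , w′∉T =
      clique⊆complete⇒≡ q-clique q′-complete
        (within-⊆ (edge-clique-within iT x∈T y∈T x≢y q-clique x∈q y∈q w∈q w∉T) x∈q′ y∈q′ w∈q′)
      where
      q′-complete : Complete G q′
      q′-complete = clique-complete q′-clique
      w∈q′ : w ∈ q′
      w∈q′ = subst (_∈ q′) (sym (apex-unique-complete iT x∈T y∈T x≢y
               (clique-complete q-clique) x∈q y∈q w∈q w∉T q′-complete x∈q′ y∈q′ w′∈q′ w′∉T)) w′∈q′

    Q-edge-at-meet : IsInternalTriangle G T₁ → MeetsOnlyAt T₁ T₂ s → IsClique G q → InQ G T₁ q → InQ G T₂ q →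
                     q ≢ T₁ × s ∈ q × ∃ λ t → t ∈ q × t ∈ T₁ × t ≢ s
    Q-edge-at-meet {T₁ = T₁} {s = s} {q} iT₁ only-s q-clique (_ , 2≤∣q∩T₁∣) (_ , 2≤∣q∩T₂∣)
      with common-pair 2≤∣q∩T₁∣ | common-pair 2≤∣q∩T₂∣ | length<∣p∣⇒fresh (q ∩ T₁) (s ∷ []) 2≤∣q∩T₁∣
    ... | x , y , x∈q , x∈T₁ , y∈q , y∈T₁ , x≢y | u , v , u∈q , u∈T₂ , v∈q , v∈T₂ , u≢v | t , t∈q∩T₁ , t≢s ∷ []
      with x∈p∩q⁻ q T₁ t∈q∩T₁
    ... | t∈q , t∈T₁ = q≢T₁ , s∈q , t , t∈q , t∈T₁ , t≢s
      where
      q≢T₁ : q ≢ T₁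
      q≢T₁ refl = u≢v (trans (only-s u∈q u∈T₂) (sym (only-s v∈q v∈T₂)))
      q-complete : Complete G q
      q-complete = clique-complete q-clique
      s∈q : s ∈ q
      s∈q with s ∈? q
      ... | yes s∈q = s∈q
      ... | no s∉q = contradiction (apex-unique-complete iT₁ x∈T₁ y∈T₁ x≢y
                       q-complete x∈q y∈q u∈q u∉T₁ q-complete x∈q y∈q v∈q v∉T₁) u≢v
        where
        u∉T₁ : u ∉ T₁
        u∉T₁ u∈T₁ = s∉q (subst (_∈ q) (only-s u∈T₁ u∈T₂) u∈q)
        v∉T₁ : v ∉ T₁
        v∉T₁ v∈T₁ = s∉q (subst (_∈ q) (only-s v∈T₁ v∈T₂) v∈q)

    module _ {T₁ T₂ : Subset n} (iT₁ : IsInternalTriangle G T₁) (iT₂ : IsInternalTriangle G T₂)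
             (T₁≢T₂ : T₁ ≢ T₂) where

      private
        T₁-clique : IsClique G T₁
        T₁-clique = proj₁ iT₁
        ∣T₁∣≡3 : ∣ T₁ ∣ ≡ 3
        ∣T₁∣≡3 = proj₁ (proj₂ iT₁)
        T₂-complete : Complete G T₂
        T₂-complete = clique-complete (proj₁ iT₂)

      shared-edge-¬apex : x ∈ T₁ → y ∈ T₁ → x ≢ y → x ∈ T₂ → y ∈ T₂ → w ∉ T₁ → w ∉ T₂ →
                          Adj G x w → Adj G y w → ⊥
      shared-edge-¬apex {x} {y} x∈T₁ y∈T₁ x≢y x∈T₂ y∈T₂ w∉T₁ w∉T₂ x∼w y∼w
        with ∣p∣≡3⇒third (proj₁ (proj₂ iT₂)) x y
      ... | f , f∈T₂ , f≢x , f≢y with f ∈? T₁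
      ... | yes f∈T₁ = T₁≢T₂ (clique⊆complete⇒≡ T₁-clique T₂-complete
                         (within-⊆ (∣p∣≡3⇒within ∣T₁∣≡3 x∈T₁ y∈T₁ f∈T₁ x≢y (≢-sym f≢x) (≢-sym f≢y))
                                   x∈T₂ y∈T₂ f∈T₂))
      ... | no f∉T₁ = w∉T₂ (subst (_∈ T₂) (apex-unique iT₁ x∈T₁ y∈T₁ x≢y f∉T₁ w∉T₁ x∼f y∼f x∼w y∼w) f∈T₂)
        where
        x∼f : Adj G x f
        x∼f = T₂-complete x f x∈T₂ f∈T₂ (≢-sym f≢x)
        y∼f : Adj G y f
        y∼f = T₂-complete y f y∈T₂ f∈T₂ (≢-sym f≢y)

      Q-edge-meets-only-at : IsClique G q → q ≢ T₂ → InQ G T₂ q → s ∈ T₁ → t ∈ T₁ → s ≢ t →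
                             s ∈ q → t ∈ q → w ∈ q → w ∉ T₁ → s ∈ T₂ → MeetsOnlyAt T₁ T₂ s
      Q-edge-meets-only-at {q} {s} {t} {w} q-clique q≢T₂ (_ , 2≤∣q∩T₂∣) s∈T₁ t∈T₁ s≢t s∈q t∈q w∈q w∉T₁ s∈T₂
        with common-pair 2≤∣q∩T₂∣
      ... | u , v , u∈q , u∈T₂ , v∈q , v∈T₂ , u≢v =
        only-common-vertex T₁-clique ∣T₁∣≡3 T₂-complete s∈T₁ t∈T₁ s≢t t∉T₂ w∈T₂ w∉T₁ s∼w t∼w
        where
        q-within : Within q s t w
        q-within = edge-clique-within iT₁ s∈T₁ t∈T₁ s≢t q-clique s∈q t∈q w∈q w∉T₁
        s∼w : Adj G s w
        s∼w = adj-across (clique-complete q-clique) s∈q w∈q s∈T₁ w∉T₁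
        t∼w : Adj G t w
        t∼w = adj-across (clique-complete q-clique) t∈q w∈q t∈T₁ w∉T₁
        t∉T₂ : t ∉ T₂
        t∉T₂ t∈T₂ with w ∈? T₂
        ... | yes w∈T₂ = q≢T₂ (clique⊆complete⇒≡ q-clique T₂-complete (within-⊆ q-within s∈T₂ t∈T₂ w∈T₂))
        ... | no w∉T₂ = shared-edge-¬apex s∈T₁ t∈T₁ s≢t s∈T₂ t∈T₂ w∉T₁ w∉T₂ s∼w t∼w
        w∈T₂ : w ∈ T₂
        w∈T₂ with w ∈? T₂
        ... | yes w∈T₂ = w∈T₂
        ... | no w∉T₂ = contradiction (trans (within-excluding q-within u∈q u∈T₂ t∉T₂ w∉T₂)
                                             (sym (within-excluding q-within v∈q v∈T₂ t∉T₂ w∉T₂))) u≢v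

      Q-meets-only-at : IsClique G q → q ≢ T₁ → q ≢ T₂ → InQ G T₁ q → InQ G T₂ q →
                        ∃ λ s → s ∈ T₁ × MeetsOnlyAt T₁ T₂ s
      Q-meets-only-at q-clique q≢T₁ q≢T₂ (_ , 2≤∣q∩T₁∣) inQ₂@(_ , 2≤∣q∩T₂∣)
        with common-pair 2≤∣q∩T₁∣ | common-pair 2≤∣q∩T₂∣ | clique≢⇒outsider q-clique (clique-complete T₁-clique) q≢T₁
      ... | x , y , x∈q , x∈T₁ , y∈q , y∈T₁ , x≢y | u , v , u∈q , u∈T₂ , v∈q , v∈T₂ , u≢v | w , w∈q , w∉T₁
        with within-two (edge-clique-within iT₁ x∈T₁ y∈T₁ x≢y q-clique x∈q y∈q w∈q w∉T₁) u∈q v∈q u≢v u∈T₂ v∈T₂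
      ... | inj₁ x∈T₂ =
        x , x∈T₁ , Q-edge-meets-only-at q-clique q≢T₂ inQ₂ x∈T₁ y∈T₁ x≢y x∈q y∈q w∈q w∉T₁ x∈T₂
      ... | inj₂ y∈T₂ =
        y , y∈T₁ , Q-edge-meets-only-at q-clique q≢T₂ inQ₂ y∈T₁ x∈T₁ (≢-sym x≢y) y∈q x∈q w∈q w∉T₁ y∈T₂

      Q∩Q-¬K-triangle : IsKTriangle G q₁ q₂ q₃ → InQ G T₁ q₁ → InQ G T₁ q₂ → InQ G T₁ q₃ →
                        InQ G T₂ q₁ → InQ G T₂ q₂ → InQ G T₂ q₃ → ⊥
      Q∩Q-¬K-triangle (c₁ , c₂ , c₃ , (q₁≢q₂ , _) , (q₂≢q₃ , _) , (q₁≢q₃ , _)) a₁ a₂ a₃ b₁ b₂ b₃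
        with avoid-two {P = λ q → IsClique G q × InQ G T₁ q × InQ G T₂ q} (≡-dec _≟ᵇ_)
               q₁≢q₂ q₂≢q₃ q₁≢q₃ (c₁ , a₁ , b₁) (c₂ , a₂ , b₂) (c₃ , a₃ , b₃) T₁ T₂
      ... | q , (c , a , b) , q≢T₁ , q≢T₂ with Q-meets-only-at c q≢T₁ q≢T₂ a b
      ... | s , s∈T₁ , only-s
        with Q-edge-at-meet iT₁ only-s c₁ a₁ b₁
           | Q-edge-at-meet iT₁ only-s c₂ a₂ b₂
           | Q-edge-at-meet iT₁ only-s c₃ a₃ b₃
      ... | q₁≢T₁ , s∈q₁ , t₁ , t₁∈q₁ , t₁∈T₁ , t₁≢s
          | q₂≢T₁ , s∈q₂ , t₂ , t₂∈q₂ , t₂∈T₁ , t₂≢s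
          | q₃≢T₁ , s∈q₃ , t₃ , t₃∈q₃ , t₃∈T₁ , t₃≢s =
        <⇒≱ (≤-reflexive (cong suc ∣T₁∣≡3))
            (distinct⇒length≤∣p∣ distinct (s∈T₁ ∷ t₁∈T₁ ∷ t₂∈T₁ ∷ t₃∈T₁ ∷ []))
        where
        t₁≢t₂ : t₁ ≢ t₂
        t₁≢t₂ refl = q₁≢q₂ (edge-clique-unique iT₁ s∈T₁ t₁∈T₁ (≢-sym t₁≢s) c₁ q₁≢T₁ s∈q₁ t₁∈q₁ c₂ q₂≢T₁ s∈q₂ t₂∈q₂)
        t₁≢t₃ : t₁ ≢ t₃
        t₁≢t₃ refl = q₁≢q₃ (edge-clique-unique iT₁ s∈T₁ t₁∈T₁ (≢-sym t₁≢s) c₁ q₁≢T₁ s∈q₁ t₁∈q₁ c₃ q₃≢T₁ s∈q₃ t₃∈q₃)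
        t₂≢t₃ : t₂ ≢ t₃
        t₂≢t₃ refl = q₂≢q₃ (edge-clique-unique iT₁ s∈T₁ t₂∈T₁ (≢-sym t₂≢s) c₂ q₂≢T₁ s∈q₂ t₂∈q₂ c₃ q₃≢T₁ s∈q₃ t₃∈q₃)
        distinct : AllPairs _≢_ (s ∷ t₁ ∷ t₂ ∷ t₃ ∷ [])
        distinct = (≢-sym t₁≢s ∷ ≢-sym t₂≢s ∷ ≢-sym t₃≢s ∷ []) ∷ (t₁≢t₂ ∷ t₁≢t₃ ∷ []) ∷ (t₂≢t₃ ∷ []) ∷ [] ∷ []

mainTheorem12 : {n : ℕ} (G : Graph n) → Connected G → MaxDegreeAtMost G 4 →
    ¬ Iso G O₃ →
    (q₁ q₂ q₃ T₁ T₂ : Subset n) → IsKTriangle G q₁ q₂ q₃ →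
    IsInternalTriangle G T₁ → IsInternalTriangle G T₂ →
    InQ G T₁ q₁ → InQ G T₁ q₂ → InQ G T₁ q₃ →
    InQ G T₂ q₁ → InQ G T₂ q₂ → InQ G T₂ q₃ →
    T₁ ≡ T₂
mainTheorem12 G _ Δ≤4 _ _ _ _ T₁ T₂ K-triangle iT₁ iT₂ a₁ a₂ a₃ b₁ b₂ b₃ with ≡-dec _≟ᵇ_ T₁ T₂
... | yes T₁≡T₂ = T₁≡T₂
... | no T₁≢T₂ = ⊥-elim (Q∩Q-¬K-triangle G Δ≤4 iT₁ iT₂ T₁≢T₂ K-triangle a₁ a₂ a₃ b₁ b₂ b₃)
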